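{- Let $m \ge 1$ and let $C$ be a binary LCD $[2m+2,2]$ code with $d(C^\perp)\ge 2$. Then there is a $2$-cover $(Y_1,Y_2)$ of the $m$-set $X=\{1,\dots,m\}$ such that $C$ is equivalent to $C((Y_1,Y_2))$.
   Context: A $2$-cover of $X$ is a sequence $(Y_1,Y_2)$ of (not necessarily distinct) subsets of $X$ with $Y_1\cup Y_2=X$. For a positive integer $a$ write $a+Y=\{a+y\mid y\in Y\}$. Set $Z_i=\{i\}\cup(2+Y_i)\cup(2+m+Y_i)\subseteq\{1,\dots,2m+2\}$ for $i=1,2$, let $z_i\in\mathbb{F}_2^{2m+2}$ be the characteristic vector of $Z_i$, and let $C((Y_1,Y_2))$ be the binary code generated by $z_1,z_2$. A binary $[n,k]$ code is a $k$-dimensional subspace of $\mathbb{F}_2^n$; $C$ is LCD if $C\cap C^\perp=\{\mathbf{0}_n\}$; $d(D)$ is the minimum nonzero Hamming weight of $D$. Two binary codes are equivalent if one is obtained from the other by a permutation of coordinates. -}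

module Defs where

open import Data.Bool using (Bool; true; false; _xor_; _∧_; _∨_; if_then_else_)
open import Data.Nat using (ℕ; zero; suc; _+_; _≤_)
open import Data.Fin using (Fin; zero; suc)
open import Data.Fin.Permutation using (Permutation′; _⟨$⟩ʳ_)
open import Data.Vec.Functional using (Vector; foldr; _++_)
open import Data.Product using (Σ; ∃; ∃-syntax; _×_; _,_)
open import Data.Empty using (⊥)
open import Relation.Nullary using (¬_)
open import Relation.Binary.PropositionalEquality using (_≡_)
open import Function using (_∘_; _⇔_)

-- Binary words of length n: vectors in 𝔽₂ⁿ (coordinates indexed by Fin n,
-- coordinate j corresponds to position j+1 of the paper).
Word : ℕ → Set
Word n = Vector Bool n

_≈_ : ∀ {n} → Word n → Word n → Set
v ≈ w = ∀ i → v i ≡ w i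

0w : ∀ {n} → Word n
0w _ = false

_⊕_ : ∀ {n} → Word n → Word n → Word n
(v ⊕ w) i = v i xor w i

_·_ : ∀ {n} → Bool → Word n → Word n
(a · w) i = a ∧ w i

dot : ∀ {n} → Word n → Word n → Bool
dot v w = foldr _xor_ false (λ i → v i ∧ w i)

weight : ∀ {n} → Word n → ℕ
weight w = foldr (λ b k → if b then suc k else k) 0 w

Code : ℕ → Set₁
Code n = Word n → Set

Span₂ : ∀ {n} → Word n → Word n → Code n
Span₂ g₁ g₂ w = ∃[ a ] ∃[ b ] (w ≈ ((a · g₁) ⊕ (b · g₂)))

LinIndep₂ : ∀ {n} → Word n → Word n → Set
LinIndep₂ g₁ g₂ = ¬ (g₁ ≈ 0w) × ¬ (g₂ ≈ 0w) × ¬ (g₁ ≈ g₂)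

Dual : ∀ {n} → Code n → Code n
Dual C w = ∀ c → C c → dot c w ≡ false

LCD : ∀ {n} → Code n → Set
LCD C = ∀ w → C w → Dual C w → w ≈ 0w

MinDist≥ : ∀ {n} → Code n → ℕ → Set
MinDist≥ D k = ∀ w → D w → ¬ (w ≈ 0w) → k ≤ weight w

Equivalent : ∀ {n} → Code n → Code n → Set
Equivalent {n} C D = Σ (Permutation′ n) λ σ → (∀ (w : Word n) → C w ⇔ D (w ∘ (σ ⟨$⟩ʳ_)))

-- subsets of X = {1,…,m} (element y ∈ Fin m stands for y+1)
Subset : ℕ → Set
Subset m = Fin m → Bool

IsCover₂ : ∀ {m} → Subset m → Subset m → Set
IsCover₂ Y₁ Y₂ = ∀ x → (Y₁ x ∨ Y₂ x) ≡ true

-- characteristic vectors of Z₁, Z₂ ⊆ {1,…,2m+2}: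
-- positions 1,2 | positions 3..m+2 (= 2+Y) | positions m+3..2m+2 (= 2+m+Y)
e₁ e₂ : Word 2
e₁ zero = true
e₁ (suc _) = false
e₂ zero = false
e₂ (suc _) = true

z : ∀ {m} → Word 2 → Subset m → Word (2 + (m + m))
z e Y = e ++ (Y ++ Y)

CY : ∀ {m} → Subset m → Subset m → Code (2 + (m + m))
CY Y₁ Y₂ = Span₂ (z e₁ Y₁) (z e₂ Y₂)

-- A 2-dimensional code is determined up to equivalence by the multiset of columns
-- (g₁ i , g₂ i) of a generator pair, i.e. by the numbers n₁₀, n₀₁, n₁₁, n₀₀ of
-- columns of each type.  Since d(C⊥) ≥ 2 there is no zero column, and the Gram
-- matrix of (g₁, g₂) is given by the parities n₁₀ + n₁₁, n₀₁ + n₁₁ and n₁₁.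
-- Replacing g₁ or g₂ by g₁ + g₂ permutes the three nonzero column types, and the
-- length 2m + 2 is even, so unless all three counts are even (then C ⊆ C⊥,
-- against LCD) one may assume n₁₀ = 2p + 1, n₀₁ = 2q + 1, n₁₁ = 2r with
-- p + q + r = m.  These are exactly the column counts of C((Y₁,Y₂)) for the cover
-- of X consisting of p points in Y₁ only, q in Y₂ only and r in both.
module Submission where

open import Defs
open import Data.Nat using (ℕ; _≤_; _+_)
open import Data.Product using (∃-syntax; _×_)

open import Algebra.Properties.CommutativeSemigroup using (x∙yz≈y∙xz)
open import Data.Bool using (Bool; true; false; not; _∧_; _∨_; _xor_; if_then_else_)
open import Data.Bool.Properties
  using (xor-identityʳ; xor-same; ∧-identityʳ; ∧-zeroʳ; ∧-distribʳ-xor; not-distribˡ-xor; not-involutive)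
  renaming (_≟_ to _≟ᵇ_)
open import Data.Bool.Solver using (module xor-∧-Solver)
open import Data.Empty using (⊥-elim)
open import Data.Fin using (Fin; zero; suc; splitAt)
open import Data.Fin.Permutation using (Permutation′; _⟨$⟩ʳ_; _⟨$⟩ˡ_; id; insert; insert-punchIn; inverseʳ)
open import Data.Nat using (zero; suc; _*_) renaming (_≟_ to _≟ℕ_)
open import Data.Nat.Properties using (+-assoc; +-cancelˡ-≡; +-commutativeSemigroup; +-suc; suc-injective; 1+n≢0; <-irrefl)
open import Data.Nat.Tactic.RingSolver using (solve-∀)
open import Data.Product using (Σ; _,_; proj₁; proj₂)
open import Data.Product.Properties using (≡-dec)
open import Data.Sum using (inj₁; inj₂)
open import Data.Vec.Functional using (Vector; foldr; _++_; zip; replicate; removeAt)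
open import Data.Vec.Functional.Relation.Unary.All using (All)
import Data.Vec.Functional.Relation.Unary.All.Properties as All
open import Function using (_∘_; _⇔_; mk⇔; Equivalence)
open import Relation.Binary.Definitions using (DecidableEquality)
open import Relation.Binary.PropositionalEquality using (_≡_; _≢_; _≗_; refl; sym; trans; cong; cong₂; subst; module ≡-Reasoning)
open import Relation.Nullary using (¬_; does; yes; no)
open import Relation.Nullary.Decidable using (dec-true; does-⇔)
open import Relation.Unary using (_⊆_; _≐_)
open import Relation.Unary.Properties using (≐-refl; ≐-sym)

open ≡-Reasoning
-- The solver normalises with coefficients in Bool itself, so it also proves
-- identities that need x xor x ≡ false.
open xor-∧-Solver using (solve; _:+_; _:*_; _:=_)

module Counting {a} {A : Set a} (_≟_ : DecidableEquality A) where

  δ : A → A → ℕ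
  δ x t = if does (x ≟ t) then 1 else 0

  count : ∀ {n} → A → Vector A n → ℕ
  count {zero}  t v = 0
  count {suc n} t v = δ (v zero) t + count t (v ∘ suc)

  δ-refl : ∀ x → δ x x ≡ 1
  δ-refl x = cong (if_then 1 else 0) (dec-true (x ≟ x) refl)

  count-cong : ∀ {n} t {u v : Vector A n} → u ≗ v → count t u ≡ count t v
  count-cong {zero}  t u≗v = refl
  count-cong {suc n} t u≗v = cong₂ _+_ (cong (λ x → δ x t) (u≗v zero)) (count-cong t (u≗v ∘ suc))

  ++-tail : ∀ {m n} (u : Vector A (suc m)) (v : Vector A n) → (u ++ v) ∘ suc ≗ (u ∘ suc) ++ v
  ++-tail {m} u v i with splitAt m i
  ... | inj₁ _ = refl
  ... | inj₂ _ = refl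

  count-++ : ∀ {m n} t (u : Vector A m) (v : Vector A n) → count t (u ++ v) ≡ count t u + count t v
  count-++ {zero}  t u v = refl
  count-++ {suc m} t u v = begin
    δ (u zero) t + count t ((u ++ v) ∘ suc)     ≡⟨ cong (δ (u zero) t +_) (count-cong t (++-tail u v)) ⟩
    δ (u zero) t + count t ((u ∘ suc) ++ v)     ≡⟨ cong (δ (u zero) t +_) (count-++ t (u ∘ suc) v) ⟩
    δ (u zero) t + (count t (u ∘ suc) + count t v) ≡⟨ sym (+-assoc (δ (u zero) t) _ _) ⟩
    count t u + count t v                          ∎

  count-replicate : ∀ n x t → count t (replicate n x) ≡ n * δ x t
  count-replicate zero    x t = refl
  count-replicate (suc n) x t = cong (δ x t +_) (count-replicate n x t)

  count-removeAt : ∀ {n} t (v : Vector A (suc n)) i → count t v ≡ δ (v i) t + count t (removeAt v i)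
  count-removeAt t v zero = refl
  count-removeAt {suc n} t v (suc i) = begin
    δ (v zero) t + count t (v ∘ suc)                                         ≡⟨ cong (δ (v zero) t +_) (count-removeAt t (v ∘ suc) i) ⟩
    δ (v zero) t + (δ (v (suc i)) t + count t (removeAt (v ∘ suc) i))       ≡⟨ x∙yz≈y∙xz +-commutativeSemigroup (δ (v zero) t) (δ (v (suc i)) t) _ ⟩
    δ (v (suc i)) t + (δ (v zero) t + count t (removeAt (v ∘ suc) i))       ∎

  count-involution : (φ : A → A) → (∀ x → φ (φ x) ≡ x) →
                     ∀ {n} t (v : Vector A n) → count t (φ ∘ v) ≡ count (φ t) v
  count-involution φ φφ≡id {zero}  t v = refl
  count-involution φ φφ≡id {suc n} t v =
    cong₂ _+_ (cong (if_then 1 else 0) (does-⇔ φx≡t⇔x≡φt (φ (v zero) ≟ t) (v zero ≟ φ t)))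
              (count-involution φ φφ≡id t (v ∘ suc))
    where
    φx≡t⇔x≡φt : φ (v zero) ≡ t ⇔ v zero ≡ φ t
    φx≡t⇔x≡φt = mk⇔ (λ e → trans (sym (φφ≡id (v zero))) (cong φ e)) (λ e → trans (cong φ e) (φφ≡id t))

  count≢0⇒∃ : ∀ {n} t (v : Vector A n) → count t v ≢ 0 → ∃[ i ] v i ≡ t
  count≢0⇒∃ {zero}  t v c≢0 = ⊥-elim (c≢0 refl)
  count≢0⇒∃ {suc n} t v c≢0 with v zero ≟ t
  ... | yes v₀≡t = zero , v₀≡t
  ... | no  _    with count≢0⇒∃ t (v ∘ suc) c≢0
  ...   | i , vᵢ≡t = suc i , vᵢ≡t

  counts⇒permutation : ∀ {n} (u v : Vector A n) → (∀ t → count t u ≡ count t v) →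
                       Σ (Permutation′ n) λ ρ → ∀ i → u (ρ ⟨$⟩ʳ i) ≡ v i
  counts⇒permutation {zero}  u v same = id , λ ()
  counts⇒permutation {suc n} u v same = insert zero i ρ , u∘ρ≡v
    where
    v₀∈u : ∃[ i ] u i ≡ v zero
    v₀∈u = count≢0⇒∃ (v zero) u λ c≡0 →
      1+n≢0 (trans (sym (trans (same (v zero)) (cong (_+ count (v zero) (v ∘ suc)) (δ-refl (v zero))))) c≡0)
    i = proj₁ v₀∈u
    same-rest : ∀ t → count t (removeAt u i) ≡ count t (v ∘ suc)
    same-rest t = +-cancelˡ-≡ (δ (v zero) t) _ _ (begin
      δ (v zero) t + count t (removeAt u i) ≡⟨ cong (λ x → δ x t + count t (removeAt u i)) (sym (proj₂ v₀∈u)) ⟩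
      δ (u i) t + count t (removeAt u i)    ≡⟨ sym (count-removeAt t u i) ⟩
      count t u                              ≡⟨ same t ⟩
      count t v                              ∎)
    rest = counts⇒permutation (removeAt u i) (v ∘ suc) same-rest
    ρ = proj₁ rest
    u∘ρ≡v : ∀ k → u (insert zero i ρ ⟨$⟩ʳ k) ≡ v k
    u∘ρ≡v zero    = proj₂ v₀∈u
    u∘ρ≡v (suc k) = trans (cong u (insert-punchIn zero i ρ k)) (proj₂ rest k)

oddᵇ : ℕ → Bool
oddᵇ zero    = false
oddᵇ (suc n) = not (oddᵇ n)

oddᵇ-+ : ∀ m n → oddᵇ (m + n) ≡ oddᵇ m xor oddᵇ n
oddᵇ-+ zero    n = refl
oddᵇ-+ (suc m) n = trans (cong not (oddᵇ-+ m n)) (not-distribˡ-xor (oddᵇ m) (oddᵇ n))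

oddᵇ-n+n : ∀ n → oddᵇ (n + n) ≡ false
oddᵇ-n+n n = trans (oddᵇ-+ n n) (xor-same (oddᵇ n))

oddᵇ≡true⇒ : ∀ n → oddᵇ n ≡ true → ∃[ k ] n ≡ suc (k + k)
oddᵇ≡false⇒ : ∀ n → oddᵇ n ≡ false → ∃[ k ] n ≡ k + k
oddᵇ≡true⇒ (suc n) odd with oddᵇ n in even
... | false with oddᵇ≡false⇒ n even
...   | k , n≡k+k = k , cong suc n≡k+k
oddᵇ≡false⇒ zero    _    = zero , refl
oddᵇ≡false⇒ (suc n) even with oddᵇ n in odd
... | true with oddᵇ≡true⇒ n odd
...   | k , n≡1+k+k = suc k , cong suc (trans n≡1+k+k (sym (+-suc k k)))

n+n-injective : ∀ m n → m + m ≡ n + n → m ≡ n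
n+n-injective zero    zero    _ = refl
n+n-injective (suc m) (suc n) e =
  cong suc (n+n-injective m n (suc-injective (trans (sym (+-suc m m)) (trans (suc-injective e) (+-suc n n)))))

Column : Set
Column = Bool × Bool

pattern c₁₁ = true  , true
pattern c₁₀ = true  , false
pattern c₀₁ = false , true
pattern c₀₀ = false , false

_≟ᶜ_ : DecidableEquality Column
_≟ᶜ_ = ≡-dec _≟ᵇ_ _≟ᵇ_

open Counting _≟ᶜ_

⨁ : ∀ {n} → Vector Bool n → Bool
⨁ = foldr _xor_ false

⨁-cong : ∀ {n} {u v : Vector Bool n} → u ≗ v → ⨁ u ≡ ⨁ v
⨁-cong {zero}  u≗v = refl
⨁-cong {suc n} u≗v = cong₂ _xor_ (u≗v zero) (⨁-cong (u≗v ∘ suc))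

⨁ᶜ : (Column → Bool) → Bool
⨁ᶜ G = G c₁₁ xor (G c₁₀ xor (G c₀₁ xor G c₀₀))

⨁ᶜ-cong : ∀ {G H : Column → Bool} → G ≗ H → ⨁ᶜ G ≡ ⨁ᶜ H
⨁ᶜ-cong G≗H = cong₂ _xor_ (G≗H c₁₁) (cong₂ _xor_ (G≗H c₁₀) (cong₂ _xor_ (G≗H c₀₁) (G≗H c₀₀)))

⨁ᶜ-xor : ∀ (G H : Column → Bool) → ⨁ᶜ (λ t → G t xor H t) ≡ ⨁ᶜ G xor ⨁ᶜ H
⨁ᶜ-xor G H = solve 8
  (λ a b c d a′ b′ c′ d′ → (a :+ a′) :+ ((b :+ b′) :+ ((c :+ c′) :+ (d :+ d′)))
                       := (a :+ (b :+ (c :+ d))) :+ (a′ :+ (b′ :+ (c′ :+ d′))))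
  refl (G c₁₁) (G c₁₀) (G c₀₁) (G c₀₀) (H c₁₁) (H c₁₀) (H c₀₁) (H c₀₀)

⨁ᶜ-δ : ∀ p (F : Column → Bool) → ⨁ᶜ (λ t → oddᵇ (δ p t) ∧ F t) ≡ F p
⨁ᶜ-δ c₁₁ F = xor-identityʳ (F c₁₁)
⨁ᶜ-δ c₁₀ F = xor-identityʳ (F c₁₀)
⨁ᶜ-δ c₀₁ F = xor-identityʳ (F c₀₁)
⨁ᶜ-δ c₀₀ F = refl

⨁-byColumnType : ∀ {n} (F : Column → Bool) (v : Vector Column n) →
                 ⨁ (F ∘ v) ≡ ⨁ᶜ (λ t → oddᵇ (count t v) ∧ F t)
⨁-byColumnType {zero}  F v = refl
⨁-byColumnType {suc n} F v = begin
  F p xor ⨁ (F ∘ v ∘ suc)                                           ≡⟨ cong (F p xor_) (⨁-byColumnType F (v ∘ suc)) ⟩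
  F p xor ⨁ᶜ (λ t → odd-rest t ∧ F t)                               ≡⟨ cong (_xor ⨁ᶜ (λ t → odd-rest t ∧ F t)) (sym (⨁ᶜ-δ p F)) ⟩
  ⨁ᶜ (λ t → oddᵇ (δ p t) ∧ F t) xor ⨁ᶜ (λ t → odd-rest t ∧ F t)     ≡⟨ sym (⨁ᶜ-xor (λ t → oddᵇ (δ p t) ∧ F t) (λ t → odd-rest t ∧ F t)) ⟩
  ⨁ᶜ (λ t → (oddᵇ (δ p t) ∧ F t) xor (odd-rest t ∧ F t))            ≡⟨ ⨁ᶜ-cong split ⟨
  ⨁ᶜ (λ t → oddᵇ (count t v) ∧ F t)                                 ∎
  where
  p = v zero
  odd-rest : Column → Bool
  odd-rest t = oddᵇ (count t (v ∘ suc))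
  split : ∀ t → oddᵇ (count t v) ∧ F t ≡ (oddᵇ (δ p t) ∧ F t) xor (odd-rest t ∧ F t)
  split t = trans (cong (_∧ F t) (oddᵇ-+ (δ p t) (count t (v ∘ suc)))) (∧-distribʳ-xor (F t) (oddᵇ (δ p t)) (odd-rest t))

count-total : ∀ {n} (v : Vector Column n) → count c₀₀ v + (count c₁₀ v + (count c₀₁ v + count c₁₁ v)) ≡ n
count-total {zero}  v = refl
count-total {suc n} v =
  trans (one-more (v zero) (count c₀₀ rest) (count c₁₀ rest) (count c₀₁ rest) (count c₁₁ rest))
        (cong suc (count-total rest))
  where
  rest = v ∘ suc
  one-more : ∀ x a b c d → (δ x c₀₀ + a) + ((δ x c₁₀ + b) + ((δ x c₀₁ + c) + (δ x c₁₁ + d)))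
                           ≡ suc (a + (b + (c + d)))
  one-more c₀₀ a b c d = refl
  one-more c₁₀ a b c d = +-suc a _
  one-more c₀₁ a b c d = trans (cong (a +_) (+-suc b _)) (+-suc a _)
  one-more c₁₁ a b c d = trans (cong (a +_) (trans (cong (b +_) (+-suc c d)) (+-suc b _))) (+-suc a _)

evenLength⇒columnParities : ∀ m (v : Vector Column (2 + (m + m))) → count c₀₀ v ≡ 0 →
                            oddᵇ (count c₁₀ v) xor (oddᵇ (count c₀₁ v) xor oddᵇ (count c₁₁ v)) ≡ false
evenLength⇒columnParities m v n₀₀≡0 = begin
  oddᵇ n₁₀ xor (oddᵇ n₀₁ xor oddᵇ n₁₁)   ≡⟨ cong (oddᵇ n₁₀ xor_) (oddᵇ-+ n₀₁ n₁₁) ⟨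
  oddᵇ n₁₀ xor oddᵇ (n₀₁ + n₁₁)          ≡⟨ oddᵇ-+ n₁₀ (n₀₁ + n₁₁) ⟨
  oddᵇ (n₁₀ + (n₀₁ + n₁₁))               ≡⟨ cong (λ n₀₀ → oddᵇ (n₀₀ + (n₁₀ + (n₀₁ + n₁₁)))) n₀₀≡0 ⟨
  oddᵇ (count c₀₀ v + (n₁₀ + (n₀₁ + n₁₁))) ≡⟨ cong oddᵇ (count-total v) ⟩
  not (not (oddᵇ (m + m)))              ≡⟨ not-involutive (oddᵇ (m + m)) ⟩
  oddᵇ (m + m)                          ≡⟨ oddᵇ-n+n m ⟩
  false                                 ∎
  where
  n₁₀ = count c₁₀ v
  n₀₁ = count c₀₁ v
  n₁₁ = count c₁₁ v

combine : Bool → Bool → Column → Bool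
combine a b c = (a ∧ proj₁ c) xor (b ∧ proj₂ c)

Span₂-⊕ˡ : ∀ {n} (g₁ g₂ : Word n) → Span₂ g₁ g₂ ≐ Span₂ (g₁ ⊕ g₂) g₂
Span₂-⊕ˡ g₁ g₂ = (λ { (a , b , w≈) → a , a xor b , λ i → trans (w≈ i) (to a b (g₁ i) (g₂ i)) })
               , (λ { (a , b , w≈) → a , a xor b , λ i → trans (w≈ i) (from a b (g₁ i) (g₂ i)) })
  where
  to : ∀ a b x y → (a ∧ x) xor (b ∧ y) ≡ (a ∧ (x xor y)) xor ((a xor b) ∧ y)
  to = solve 4 (λ a b x y → (a :* x) :+ (b :* y) := (a :* (x :+ y)) :+ ((a :+ b) :* y)) refl
  from : ∀ a b x y → (a ∧ (x xor y)) xor (b ∧ y) ≡ (a ∧ x) xor ((a xor b) ∧ y)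
  from = solve 4 (λ a b x y → (a :* (x :+ y)) :+ (b :* y) := (a :* x) :+ ((a :+ b) :* y)) refl

Span₂-⊕ʳ : ∀ {n} (g₁ g₂ : Word n) → Span₂ g₁ g₂ ≐ Span₂ g₁ (g₁ ⊕ g₂)
Span₂-⊕ʳ g₁ g₂ = (λ { (a , b , w≈) → a xor b , b , λ i → trans (w≈ i) (to a b (g₁ i) (g₂ i)) })
               , (λ { (a , b , w≈) → a xor b , b , λ i → trans (w≈ i) (from a b (g₁ i) (g₂ i)) })
  where
  to : ∀ a b x y → (a ∧ x) xor (b ∧ y) ≡ ((a xor b) ∧ x) xor (b ∧ (x xor y))
  to = solve 4 (λ a b x y → (a :* x) :+ (b :* y) := ((a :+ b) :* x) :+ (b :* (x :+ y))) refl
  from : ∀ a b x y → (a ∧ x) xor (b ∧ (x xor y)) ≡ ((a xor b) ∧ x) xor (b ∧ y)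
  from = solve 4 (λ a b x y → (a :* x) :+ (b :* (x :+ y)) := ((a :+ b) :* x) :+ (b :* y)) refl

evenColumns⇒selfOrthogonal : ∀ {n} (g₁ g₂ : Word n) → (∀ t → oddᵇ (count t (zip g₁ g₂)) ≡ false) →
                             Span₂ g₁ g₂ ⊆ Dual (Span₂ g₁ g₂)
evenColumns⇒selfOrthogonal g₁ g₂ even {w} (a , b , w≈) c (a′ , b′ , c≈) = begin
  dot c w                                                    ≡⟨ ⨁-cong (λ i → cong₂ _∧_ (c≈ i) (w≈ i)) ⟩
  ⨁ (F ∘ zip g₁ g₂)                                          ≡⟨ ⨁-byColumnType F (zip g₁ g₂) ⟩
  ⨁ᶜ (λ t → oddᵇ (count t (zip g₁ g₂)) ∧ F t)               ≡⟨ ⨁ᶜ-cong (λ t → cong (_∧ F t) (even t)) ⟩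
  false                                                      ∎
  where
  F : Column → Bool
  F t = combine a′ b′ t ∧ combine a b t

unit : ∀ {n} → Fin n → Word n
unit zero    zero    = true
unit zero    (suc _) = false
unit (suc i) zero    = false
unit (suc i) (suc j) = unit i j

unit-diagonal : ∀ {n} (i : Fin n) → unit i i ≡ true
unit-diagonal zero    = refl
unit-diagonal (suc i) = unit-diagonal i

weight-0w : ∀ {n} → weight {n} 0w ≡ 0
weight-0w {zero}  = refl
weight-0w {suc n} = weight-0w {n}

weight-unit : ∀ {n} (i : Fin n) → weight (unit i) ≡ 1
weight-unit {suc n} zero    = cong suc (weight-0w {n})
weight-unit {suc n} (suc i) = weight-unit i

dot-0w : ∀ {n} (v : Word n) → dot v 0w ≡ false
dot-0w {zero}  v = refl
dot-0w {suc n} v = cong₂ _xor_ (∧-zeroʳ (v zero)) (dot-0w (v ∘ suc))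

dot-unit : ∀ {n} (v : Word n) (i : Fin n) → dot v (unit i) ≡ v i
dot-unit {suc n} v zero    = trans (cong₂ _xor_ (∧-identityʳ (v zero)) (dot-0w (v ∘ suc))) (xor-identityʳ (v zero))
dot-unit {suc n} v (suc i) = cong₂ _xor_ (∧-zeroʳ (v zero)) (dot-unit (v ∘ suc) i)

minDist≥2⇒noZeroColumn : ∀ {n} (g₁ g₂ : Word n) → MinDist≥ (Dual (Span₂ g₁ g₂)) 2 → count c₀₀ (zip g₁ g₂) ≡ 0
minDist≥2⇒noZeroColumn g₁ g₂ d⊥≥2 with count c₀₀ (zip g₁ g₂) ≟ℕ 0
... | yes none = none
... | no some with count≢0⇒∃ c₀₀ (zip g₁ g₂) some
...   | i , zeroColumn = ⊥-elim (<-irrefl refl (subst (2 ≤_) (weight-unit i) (d⊥≥2 (unit i) unitᵢ∈C⊥ unitᵢ≉0)))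
  where
  unitᵢ∈C⊥ : Dual (Span₂ g₁ g₂) (unit i)
  unitᵢ∈C⊥ c (a , b , c≈) = begin
    dot c (unit i)               ≡⟨ dot-unit c i ⟩
    c i                          ≡⟨ c≈ i ⟩
    combine a b (zip g₁ g₂ i)   ≡⟨ cong (combine a b) zeroColumn ⟩
    (a ∧ false) xor (b ∧ false) ≡⟨ cong₂ _xor_ (∧-zeroʳ a) (∧-zeroʳ b) ⟩
    false                        ∎
  unitᵢ≉0 : ¬ unit i ≈ 0w
  unitᵢ≉0 unit≈0 with trans (sym (unit-diagonal i)) (unit≈0 i)
  ... | ()

Equivalent-respˡ-≐ : ∀ {n} {C C′ D : Code n} → C ≐ C′ → Equivalent C D → Equivalent C′ D
Equivalent-respˡ-≐ (C⊆C′ , C′⊆C) (σ , C⇔D) = σ , λ w → mk⇔ (to (C⇔D w) ∘ C′⊆C) (C⊆C′ ∘ from (C⇔D w))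
  where open Equivalence

equalColumnCounts⇒Equivalent : ∀ {n} (h₁ h₂ k₁ k₂ : Word n) →
                               (∀ t → count t (zip h₁ h₂) ≡ count t (zip k₁ k₂)) →
                               Equivalent (Span₂ h₁ h₂) (Span₂ k₁ k₂)
equalColumnCounts⇒Equivalent h₁ h₂ k₁ k₂ same = ρ , λ w → mk⇔ (to w) (from w)
  where
  permutation = counts⇒permutation (zip h₁ h₂) (zip k₁ k₂) same
  ρ = proj₁ permutation
  h∘ρ≡k : ∀ i → zip h₁ h₂ (ρ ⟨$⟩ʳ i) ≡ zip k₁ k₂ i
  h∘ρ≡k = proj₂ permutation
  to : ∀ w → Span₂ h₁ h₂ w → Span₂ k₁ k₂ (w ∘ (ρ ⟨$⟩ʳ_))
  to w (a , b , w≈) = a , b , λ i → trans (w≈ (ρ ⟨$⟩ʳ i)) (cong (combine a b) (h∘ρ≡k i))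
  from : ∀ w → Span₂ k₁ k₂ (w ∘ (ρ ⟨$⟩ʳ_)) → Span₂ h₁ h₂ w
  from w (a , b , w∘ρ≈) = a , b , λ j → begin
    w j                                     ≡⟨ cong w (inverseʳ ρ) ⟨
    w (ρ ⟨$⟩ʳ (ρ ⟨$⟩ˡ j))                   ≡⟨ w∘ρ≈ (ρ ⟨$⟩ˡ j) ⟩
    combine a b (zip k₁ k₂ (ρ ⟨$⟩ˡ j))      ≡⟨ cong (combine a b) (h∘ρ≡k (ρ ⟨$⟩ˡ j)) ⟨
    combine a b (zip h₁ h₂ (ρ ⟨$⟩ʳ (ρ ⟨$⟩ˡ j))) ≡⟨ cong (combine a b ∘ zip h₁ h₂) (inverseʳ ρ) ⟩
    combine a b (zip h₁ h₂ j)               ∎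

-- The column counts of C((Y₁,Y₂)) for a 2-cover: n₁₀ = 1 + 2|Y₁ ∖ Y₂|,
-- n₀₁ = 1 + 2|Y₂ ∖ Y₁|, n₁₁ = 2|Y₁ ∩ Y₂| and n₀₀ = 0.
NormalForm : ∀ {n} → Word n → Word n → Set
NormalForm h₁ h₂ = count c₀₀ v ≡ 0 × oddᵇ (count c₁₀ v) ≡ true × oddᵇ (count c₀₁ v) ≡ true × oddᵇ (count c₁₁ v) ≡ false
  where v = zip h₁ h₂

addˡ addʳ : Column → Column
addˡ c = proj₁ c xor proj₂ c , proj₂ c
addʳ c = proj₁ c , proj₁ c xor proj₂ c

addˡ-involutive : ∀ c → addˡ (addˡ c) ≡ c
addˡ-involutive (x , y) = cong (_, y) (solve 2 (λ x y → (x :+ y) :+ y := x) refl x y)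

addʳ-involutive : ∀ c → addʳ (addʳ c) ≡ c
addʳ-involutive (x , y) = cong (x ,_) (solve 2 (λ x y → x :+ (x :+ y) := y) refl x y)

count-zip-⊕ˡ : ∀ {n} t (g₁ g₂ : Word n) → count t (zip (g₁ ⊕ g₂) g₂) ≡ count (addˡ t) (zip g₁ g₂)
count-zip-⊕ˡ t g₁ g₂ = count-involution addˡ addˡ-involutive t (zip g₁ g₂)

count-zip-⊕ʳ : ∀ {n} t (g₁ g₂ : Word n) → count t (zip g₁ (g₁ ⊕ g₂)) ≡ count (addʳ t) (zip g₁ g₂)
count-zip-⊕ʳ t g₁ g₂ = count-involution addʳ addʳ-involutive t (zip g₁ g₂)

normalForm : ∀ m (g₁ g₂ : Word (2 + (m + m))) → ¬ g₁ ≈ 0w → LCD (Span₂ g₁ g₂) → count c₀₀ (zip g₁ g₂) ≡ 0 →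
             ∃[ h₁ ] ∃[ h₂ ] (Span₂ g₁ g₂ ≐ Span₂ h₁ h₂ × NormalForm h₁ h₂)
normalForm m g₁ g₂ g₁≉0 lcd n₀₀≡0 =
  byParities _ _ _ refl refl refl (evenLength⇒columnParities m (zip g₁ g₂) n₀₀≡0)
  where
  v = zip g₁ g₂
  byParities : ∀ p₁₀ p₀₁ p₁₁ → oddᵇ (count c₁₀ v) ≡ p₁₀ → oddᵇ (count c₀₁ v) ≡ p₀₁ → oddᵇ (count c₁₁ v) ≡ p₁₁ →
               p₁₀ xor (p₀₁ xor p₁₁) ≡ false → ∃[ h₁ ] ∃[ h₂ ] (Span₂ g₁ g₂ ≐ Span₂ h₁ h₂ × NormalForm h₁ h₂)
  byParities true  true  false o₁₀ o₀₁ o₁₁ _ = g₁ , g₂ , ≐-refl , n₀₀≡0 , o₁₀ , o₀₁ , o₁₁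
  byParities true  false true  o₁₀ o₀₁ o₁₁ _ =
    g₁ ⊕ g₂ , g₂ , Span₂-⊕ˡ g₁ g₂ ,
    trans (count-zip-⊕ˡ c₀₀ g₁ g₂) n₀₀≡0 , trans (cong oddᵇ (count-zip-⊕ˡ c₁₀ g₁ g₂)) o₁₀ ,
    trans (cong oddᵇ (count-zip-⊕ˡ c₀₁ g₁ g₂)) o₁₁ , trans (cong oddᵇ (count-zip-⊕ˡ c₁₁ g₁ g₂)) o₀₁
  byParities false true  true  o₁₀ o₀₁ o₁₁ _ =
    g₁ , g₁ ⊕ g₂ , Span₂-⊕ʳ g₁ g₂ ,
    trans (count-zip-⊕ʳ c₀₀ g₁ g₂) n₀₀≡0 , trans (cong oddᵇ (count-zip-⊕ʳ c₁₀ g₁ g₂)) o₁₁ ,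
    trans (cong oddᵇ (count-zip-⊕ʳ c₀₁ g₁ g₂)) o₀₁ , trans (cong oddᵇ (count-zip-⊕ʳ c₁₁ g₁ g₂)) o₁₀
  byParities false false false o₁₀ o₀₁ o₁₁ _ =
    ⊥-elim (g₁≉0 (lcd g₁ g₁∈C (evenColumns⇒selfOrthogonal g₁ g₂ even g₁∈C)))
    where
    g₁∈C : Span₂ g₁ g₂ g₁
    g₁∈C = true , false , λ i → sym (xor-identityʳ (g₁ i))
    even : ∀ t → oddᵇ (count t v) ≡ false
    even c₁₁ = o₁₁
    even c₁₀ = o₁₀
    even c₀₁ = o₀₁
    even c₀₀ = cong oddᵇ n₀₀≡0
  byParities true  true  true  _ _ _ ()
  byParities true  false false _ _ _ ()
  byParities false true  false _ _ _ ()
  byParities false false true  _ _ _ ()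

zip-++ : ∀ {m n} (u u′ : Vector Bool m) (v v′ : Vector Bool n) → zip (u ++ v) (u′ ++ v′) ≗ zip u u′ ++ zip v v′
zip-++ {m} u u′ v v′ i with splitAt m i
... | inj₁ _ = refl
... | inj₂ _ = refl

count-CY : ∀ {m} t (Y₁ Y₂ : Subset m) →
           count t (zip (z e₁ Y₁) (z e₂ Y₂)) ≡ count t (zip e₁ e₂) + (count t (zip Y₁ Y₂) + count t (zip Y₁ Y₂))
count-CY t Y₁ Y₂ = begin
  count t (zip (z e₁ Y₁) (z e₂ Y₂))                          ≡⟨ count-cong t (zip-++ e₁ e₂ (Y₁ ++ Y₁) (Y₂ ++ Y₂)) ⟩
  count t (zip e₁ e₂ ++ zip (Y₁ ++ Y₁) (Y₂ ++ Y₂))           ≡⟨ count-++ t (zip e₁ e₂) (zip (Y₁ ++ Y₁) (Y₂ ++ Y₂)) ⟩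
  count t (zip e₁ e₂) + count t (zip (Y₁ ++ Y₁) (Y₂ ++ Y₂))  ≡⟨ cong (count t (zip e₁ e₂) +_) (count-cong t (zip-++ Y₁ Y₂ Y₁ Y₂)) ⟩
  count t (zip e₁ e₂) + count t (zip Y₁ Y₂ ++ zip Y₁ Y₂)     ≡⟨ cong (count t (zip e₁ e₂) +_) (count-++ t (zip Y₁ Y₂) (zip Y₁ Y₂)) ⟩
  count t (zip e₁ e₂) + (count t (zip Y₁ Y₂) + count t (zip Y₁ Y₂)) ∎

coverColumns : ∀ p q r → Vector Column (p + (q + r))
coverColumns p q r = replicate p c₁₀ ++ (replicate q c₀₁ ++ replicate r c₁₁)

Covered : Column → Set
Covered c = (proj₁ c ∨ proj₂ c) ≡ true

coverColumns-covered : ∀ p q r → All Covered (coverColumns p q r)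
coverColumns-covered p q r =
  All.++⁺ Covered {xs = replicate p c₁₀} (All.replicate⁺ {P = Covered} {x = c₁₀} refl)
    (All.++⁺ Covered {xs = replicate q c₀₁} {ys = replicate r c₁₁}
       (All.replicate⁺ {P = Covered} {x = c₀₁} refl) (All.replicate⁺ {P = Covered} {x = c₁₁} refl))

count-coverColumns : ∀ p q r t → count t (coverColumns p q r) ≡ p * δ c₁₀ t + (q * δ c₀₁ t + r * δ c₁₁ t)
count-coverColumns p q r t = begin
  count t (coverColumns p q r)                                                     ≡⟨ count-++ t (replicate p c₁₀) _ ⟩
  count t (replicate p c₁₀) + count t (replicate q c₀₁ ++ replicate r c₁₁)          ≡⟨ cong (count t (replicate p c₁₀) +_) (count-++ t (replicate q c₀₁) _) ⟩
  count t (replicate p c₁₀) + (count t (replicate q c₀₁) + count t (replicate r c₁₁)) ≡⟨ cong₂ _+_ (count-replicate p c₁₀ t) (cong₂ _+_ (count-replicate q c₀₁ t) (count-replicate r c₁₁ t)) ⟩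
  p * δ c₁₀ t + (q * δ c₀₁ t + r * δ c₁₁ t)                                         ∎

coverWithCounts : ∀ m p q r → p + (q + r) ≡ m →
                  ∃[ Y₁ ] ∃[ Y₂ ] (IsCover₂ {m} Y₁ Y₂ ×
                                   count c₁₀ (zip Y₁ Y₂) ≡ p × count c₀₁ (zip Y₁ Y₂) ≡ q ×
                                   count c₁₁ (zip Y₁ Y₂) ≡ r × count c₀₀ (zip Y₁ Y₂) ≡ 0)
coverWithCounts .(p + (q + r)) p q r refl =
  proj₁ ∘ v , proj₂ ∘ v , coverColumns-covered p q r ,
  trans (count-coverColumns p q r c₁₀) (only-p p q r) ,
  trans (count-coverColumns p q r c₀₁) (only-q p q r) ,
  trans (count-coverColumns p q r c₁₁) (only-r p q r) ,
  trans (count-coverColumns p q r c₀₀) (none p q r)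
  where
  v = coverColumns p q r
  only-p : ∀ p q r → p * 1 + (q * 0 + r * 0) ≡ p
  only-p = solve-∀
  only-q : ∀ p q r → p * 0 + (q * 1 + r * 0) ≡ q
  only-q = solve-∀
  only-r : ∀ p q r → p * 0 + (q * 0 + r * 1) ≡ r
  only-r = solve-∀
  none : ∀ p q r → p * 0 + (q * 0 + r * 0) ≡ 0
  none = solve-∀

oddOddEven-length : ∀ m (v : Vector Column (2 + (m + m))) p q r →
                    count c₀₀ v ≡ 0 → count c₁₀ v ≡ suc (p + p) → count c₀₁ v ≡ suc (q + q) → count c₁₁ v ≡ r + r →
                    p + (q + r) ≡ m
oddOddEven-length m v p q r n₀₀≡0 n₁₀≡ n₀₁≡ n₁₁≡ =
  n+n-injective (p + (q + r)) m (suc-injective (suc-injective (begin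
    2 + ((p + (q + r)) + (p + (q + r)))                       ≡⟨ regroup p q r ⟩
    suc (p + p) + (suc (q + q) + (r + r))                     ≡⟨ cong₂ _+_ n₁₀≡ (cong₂ _+_ n₀₁≡ n₁₁≡) ⟨
    count c₁₀ v + (count c₀₁ v + count c₁₁ v)                 ≡⟨ cong (_+ (count c₁₀ v + (count c₀₁ v + count c₁₁ v))) n₀₀≡0 ⟨
    count c₀₀ v + (count c₁₀ v + (count c₀₁ v + count c₁₁ v)) ≡⟨ count-total v ⟩
    2 + (m + m)                                               ∎)))
  where
  regroup : ∀ p q r → 2 + ((p + (q + r)) + (p + (q + r))) ≡ suc (p + p) + (suc (q + q) + (r + r))
  regroup = solve-∀

normalForm⇒cover : ∀ m (h₁ h₂ : Word (2 + (m + m))) → NormalForm h₁ h₂ →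
                   ∃[ Y₁ ] ∃[ Y₂ ] (IsCover₂ {m} Y₁ Y₂ × Equivalent (Span₂ h₁ h₂) (CY Y₁ Y₂))
normalForm⇒cover m h₁ h₂ (n₀₀≡0 , odd₁₀ , odd₀₁ , even₁₁) =
  let p , n₁₀≡ = oddᵇ≡true⇒ _ odd₁₀
      q , n₀₁≡ = oddᵇ≡true⇒ _ odd₀₁
      r , n₁₁≡ = oddᵇ≡false⇒ _ even₁₁
      Y₁ , Y₂ , cover , k₁₀ , k₀₁ , k₁₁ , k₀₀ =
        coverWithCounts m p q r (oddOddEven-length m (zip h₁ h₂) p q r n₀₀≡0 n₁₀≡ n₀₁≡ n₁₁≡)
      source : ∀ t → count t (zip h₁ h₂) ≡ count t (zip e₁ e₂) + (count t (zip Y₁ Y₂) + count t (zip Y₁ Y₂))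
      source = λ where
        c₁₀ → trans n₁₀≡ (cong (λ k → suc (k + k)) (sym k₁₀))
        c₀₁ → trans n₀₁≡ (cong (λ k → suc (k + k)) (sym k₀₁))
        c₁₁ → trans n₁₁≡ (cong (λ k → k + k) (sym k₁₁))
        c₀₀ → trans n₀₀≡0 (cong (λ k → k + k) (sym k₀₀))
  in  Y₁ , Y₂ , cover ,
      equalColumnCounts⇒Equivalent h₁ h₂ (z e₁ Y₁) (z e₂ Y₂) (λ t → trans (source t) (sym (count-CY t Y₁ Y₂)))

proposition3p3 : ∀ (m : ℕ) → 1 ≤ m →
    ∀ (g₁ g₂ : Word (2 + (m + m))) → LinIndep₂ g₁ g₂ →
    LCD (Span₂ g₁ g₂) → MinDist≥ (Dual (Span₂ g₁ g₂)) 2 →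
    ∃[ Y₁ ] ∃[ Y₂ ] (IsCover₂ {m} Y₁ Y₂ × Equivalent (Span₂ g₁ g₂) (CY Y₁ Y₂))
proposition3p3 m _ g₁ g₂ (g₁≉0 , _ , _) lcd d⊥≥2 =
  let h₁ , h₂ , C≐H , normal = normalForm m g₁ g₂ g₁≉0 lcd (minDist≥2⇒noZeroColumn g₁ g₂ d⊥≥2)
      Y₁ , Y₂ , cover , H≃CY = normalForm⇒cover m h₁ h₂ normal
  in  Y₁ , Y₂ , cover , Equivalent-respˡ-≐ {D = CY Y₁ Y₂} (≐-sym C≐H) H≃CY
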